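{- Let $\Gamma$ be a finite, undirected, connected 3-GNDB graph of diameter $2$. Then $\Gamma$ is isomorphic to the complete bipartite graph $K_{n,3n}$ for some positive integer $n$.
   Context: All graphs are finite, simple, undirected and connected, with at least one edge. For vertices $a,b$, $d(a,b)$ denotes the length of a shortest $a$–$b$ path. For an edge $ab$, $W_{ab}=\{x\in V(\Gamma)\mid d(x,a)<d(x,b)\}$. A graph $\Gamma$ is called generalized 3-nicely distance-balanced (3-GNDB) if there is a positive integer $\gamma_\Gamma$ such that for every edge $ab$ of $\Gamma$, one of $|W_{ab}|,|W_{ba}|$ equals $3$ times the other, and the smaller of the two equals $\gamma_\Gamma$. -}

module Defs where

open import Data.Nat using (ℕ; zero; suc; _<_; _≤_; _*_; _+_)
open import Data.Fin using (Fin)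
open import Data.Fin.Subset using (Subset; _∈_; ∣_∣)
open import Data.Sum using (_⊎_; inj₁; inj₂)
open import Data.Product using (Σ; ∃; ∃-syntax; _×_; _,_)
open import Data.Empty using (⊥)
open import Data.Unit using (⊤)
open import Relation.Nullary using (¬_)
open import Relation.Binary.Definitions using (Decidable)
open import Relation.Binary.PropositionalEquality using (_≡_)
open import Function.Bundles using (_⇔_; _↔_; Inverse)

record Graph : Set₁ where
  field
    N     : ℕ
    _~_   : Fin N → Fin N → Set
    adj?  : Decidable _~_
    sym   : ∀ {a b} → a ~ b → b ~ a
    irr   : ∀ {a} → ¬ (a ~ a)

module _ (Γ : Graph) where
  open Graph Γ

  data Walk : Fin N → Fin N → ℕ → Set where
    here : ∀ {a} → Walk a a 0
    step : ∀ {a c b k} → a ~ c → Walk c b k → Walk a b (suc k)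

  Dist : Fin N → Fin N → ℕ → Set
  Dist a b k = Walk a b k × (∀ j → j < k → ¬ Walk a b j)

  Connected : Set
  Connected = ∀ a b → ∃[ k ] Walk a b k

  Diameter2 : Set
  Diameter2 = (∀ a b → ∃[ k ] (k ≤ 2 × Dist a b k))
            × (∃[ a ] ∃[ b ] Dist a b 2)

  InW : Fin N → Fin N → Fin N → Set
  InW a b x = ∃[ i ] ∃[ j ] (Dist x a i × Dist x b j × i < j)

  HasSize : (Fin N → Set) → ℕ → Set
  HasSize P m = Σ (Subset N) λ s → (∀ x → (x ∈ s) ⇔ P x) × ∣ s ∣ ≡ m

  GNDB3 : Set
  GNDB3 = ∃[ γ ] (0 < γ × (∀ a b → a ~ b →
            (HasSize (InW a b) γ × HasSize (InW b a) (3 * γ))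
          ⊎ (HasSize (InW b a) γ × HasSize (InW a b) (3 * γ))))

KAdj : ∀ {m k} → (Fin m ⊎ Fin k) → (Fin m ⊎ Fin k) → Set
KAdj (inj₁ _) (inj₁ _) = ⊥
KAdj (inj₁ _) (inj₂ _) = ⊤
KAdj (inj₂ _) (inj₁ _) = ⊤
KAdj (inj₂ _) (inj₂ _) = ⊥

IsoToK : Graph → ℕ → ℕ → Set
IsoToK Γ m k = Σ (Fin N ↔ (Fin m ⊎ Fin k)) λ f →
    ∀ u v → (u ~ v) ⇔ KAdj (Inverse.to f u) (Inverse.to f v)
  where open Graph Γ

-- For an edge ab of a graph of diameter at most 2, W_ab consists of a together
-- with the neighbours of a that are neither b nor adjacent to b, so
-- |W_ab| = deg a − t(a,b), where t(a,b) counts the common neighbours of a and b.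
-- The 3-GNDB condition thus makes the degrees of adjacent vertices differ by
-- exactly 2γ.  Three numbers cannot differ pairwise by the same positive amount,
-- so Γ is triangle-free; then t = 0 and every edge joins a vertex of degree γ to
-- one of degree 3γ.  Two vertices of different degree cannot be at distance 2
-- (the middle vertex would need both degrees), so by diameter 2 the edges are
-- exactly the pairs of a low and a high vertex: Γ is complete bipartite, with γ
-- high vertices (the neighbours of a low one) and 3γ low ones.
module Submission where

open import Defs
open import Data.Nat using (ℕ; _<_; _*_)
open import Data.Product using (∃-syntax; _×_)

open import Level using (Level)
open import Data.Bool using (Bool; true; false; if_then_else_)
open import Data.Empty using (⊥; ⊥-elim)
open import Data.Fin using (Fin; zero; suc; _≟_)
open import Data.Fin.Properties using (suc-injective; +↔⊎)
open import Data.Fin.Subset using (Subset; ∣_∣)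
open import Data.Fin.Subset.Properties using (_∈?_; drop-there)
open import Data.Nat using (zero; suc; _+_; _≤_; z≤n; s≤s)
open import Data.Nat.Properties
  using (+-suc; +-comm; +-identityʳ; <⇒≢; m<m+n; m≤m+n; <-≤-trans; ≤-<-trans; ≤⇒≯)
  renaming (_≟_ to _≟ℕ_)
open import Data.Nat.Tactic.RingSolver using (solve-∀)
open import Data.Product using (Σ; ∃; _,_; proj₁; proj₂; swap)
open import Data.Sum using (_⊎_; inj₁; inj₂; [_,_]′)
open import Data.Sum.Algebra using (⊎-cong; ⊎-comm; ⊎-assoc)
open import Data.Vec using (_∷_; []; there)
open import Function using (_∘_; const)
open import Function.Bundles using (_⇔_; _↔_; Inverse; mk⇔; Equivalence)
open import Function.Construct.Composition using (_↔-∘_; _⇔-∘_)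
open import Function.Construct.Identity using (↔-id)
open import Function.Construct.Symmetry using (↔-sym)
open import Relation.Binary.PropositionalEquality
open import Relation.Nullary using (¬_; Dec; yes; no; does; ¬?; _×-dec_; _⊎-dec_)
open import Relation.Nullary.Decidable using (does-⇔; dec-true; dec-false)
open import Relation.Unary using (Pred; Decidable)

private variable
  ℓ : Level
  n : ℕ
  A B : Set

count : {P : Pred (Fin n) ℓ} → Decidable P → ℕ
count {zero}  P? = 0
count {suc n} P? = (if does (P? zero) then 1 else 0) + count (P? ∘ suc)

count-cong : {P Q : Pred (Fin n) ℓ} (P? : Decidable P) (Q? : Decidable Q) →
             (∀ x → P x ⇔ Q x) → count P? ≡ count Q?
count-cong {n = zero}  P? Q? P⇔Q = refl
count-cong {n = suc n} P? Q? P⇔Q =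
  cong₂ _+_ (cong (λ b → if b then 1 else 0) (does-⇔ (P⇔Q zero) (P? zero) (Q? zero)))
            (count-cong (P? ∘ suc) (Q? ∘ suc) (P⇔Q ∘ suc))

count-⊎ : {P Q : Pred (Fin n) ℓ} (P? : Decidable P) (Q? : Decidable Q) →
          (∀ x → P x → Q x → ⊥) → count (λ x → P? x ⊎-dec Q? x) ≡ count P? + count Q?
count-⊎ {n = zero}  P? Q? disjoint = refl
count-⊎ {n = suc n} P? Q? disjoint with P? zero | Q? zero
... | yes p | yes q = ⊥-elim (disjoint zero p q)
... | yes _ | no  _ = cong suc rest
  where rest = count-⊎ (P? ∘ suc) (Q? ∘ suc) (disjoint ∘ suc)
... | no  _ | yes _ = trans (cong suc rest) (sym (+-suc (count (P? ∘ suc)) _))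
  where rest = count-⊎ (P? ∘ suc) (Q? ∘ suc) (disjoint ∘ suc)
... | no  _ | no  _ = count-⊎ (P? ∘ suc) (Q? ∘ suc) (disjoint ∘ suc)

count-none : {P : Pred (Fin n) ℓ} (P? : Decidable P) → (∀ x → ¬ P x) → count P? ≡ 0
count-none {n = zero}  P? none = refl
count-none {n = suc n} P? none with P? zero
... | yes p = ⊥-elim (none zero p)
... | no  _ = count-none (P? ∘ suc) (none ∘ suc)

count-≡ : (c : Fin n) → count (_≟ c) ≡ 1
count-≡ {suc n} zero    = cong suc (count-none {n = n} (λ x → suc x ≟ zero) λ _ ())
count-≡ {suc n} (suc c) = trans (count-cong (λ x → suc x ≟ suc c) (_≟ c)
                                    (λ x → mk⇔ suc-injective (cong suc)))
                        (count-≡ c)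

∣p∣≡count∈-tail : ∀ {b} (p : Subset n) → ∣ p ∣ ≡ count (λ x → suc x ∈? (b ∷ p))
∣p∣≡count∈ : (p : Subset n) → ∣ p ∣ ≡ count (_∈? p)
∣p∣≡count∈ []            = refl
∣p∣≡count∈ (true  ∷ p) = cong suc (∣p∣≡count∈-tail p)
∣p∣≡count∈ (false ∷ p) = ∣p∣≡count∈-tail p

∣p∣≡count∈-tail {b = b} p =
  trans (∣p∣≡count∈ p) (count-cong (_∈? p) (λ x → suc x ∈? (b ∷ p)) λ x → mk⇔ there drop-there)

isLeft : A ⊎ B → Bool
isLeft = [ const true , const false ]′

consˡ : {a : ℕ} → Fin n ↔ (Fin a ⊎ B) → Fin (suc n) ↔ (Fin (suc a) ⊎ B)
consˡ f = ⊎-cong (↔-sym +↔⊎) (↔-id _)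
      ↔-∘ (↔-sym (⊎-assoc _ _ _ _) ↔-∘ (⊎-cong (↔-id _) f ↔-∘ +↔⊎))

consʳ : {b : ℕ} → Fin n ↔ (A ⊎ Fin b) → Fin (suc n) ↔ (A ⊎ Fin (suc b))
consʳ f = ⊎-comm _ _ ↔-∘ consˡ (⊎-comm _ _ ↔-∘ f)

isLeft-consˡ : {a : ℕ} (f : Fin n ↔ (Fin a ⊎ B)) (x : Fin n) →
               isLeft (Inverse.to (consˡ f) (suc x)) ≡ isLeft (Inverse.to f x)
isLeft-consˡ f x with Inverse.to f x
... | inj₁ _ = refl
... | inj₂ _ = refl

isLeft-consʳ : {b : ℕ} (f : Fin n ↔ (A ⊎ Fin b)) (x : Fin n) →
               isLeft (Inverse.to (consʳ f) (suc x)) ≡ isLeft (Inverse.to f x)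
isLeft-consʳ f x with Inverse.to f x
... | inj₁ _ = refl
... | inj₂ _ = refl

partition↔ : {P : Pred (Fin n) ℓ} (P? : Decidable P) →
  Σ (Fin n ↔ (Fin (count P?) ⊎ Fin (count (¬? ∘ P?)))) λ f →
    ∀ x → isLeft (Inverse.to f x) ≡ does (P? x)
partition↔ {n = zero} P? = +↔⊎ {0} {0} , λ ()
partition↔ {n = suc n} P? with P? zero | partition↔ (P? ∘ suc)
... | yes p | f , side = consˡ f , λ
  { zero → sym (dec-true (P? zero) p) ; (suc x) → trans (isLeft-consˡ f x) (side x) }
... | no ¬p | f , side = consʳ f , λ
  { zero → sym (dec-false (P? zero) ¬p) ; (suc x) → trans (isLeft-consʳ f x) (side x) }

crossing⇔KAdj : {m k : ℕ} {A B : Set} (A? : Dec A) (B? : Dec B) (y z : Fin m ⊎ Fin k) →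
  isLeft y ≡ does A? → isLeft z ≡ does B? → (A × ¬ B ⊎ ¬ A × B) ⇔ KAdj y z
crossing⇔KAdj (yes a) (yes b) (inj₁ _) (inj₁ _) _ _ =
  mk⇔ (λ { (inj₁ (_ , ¬b)) → ¬b b ; (inj₂ (¬a , _)) → ¬a a }) λ ()
crossing⇔KAdj (yes a) (no ¬b) (inj₁ _) (inj₂ _) _ _ = mk⇔ _ λ _ → inj₁ (a , ¬b)
crossing⇔KAdj (no ¬a) (yes b) (inj₂ _) (inj₁ _) _ _ = mk⇔ _ λ _ → inj₂ (¬a , b)
crossing⇔KAdj (no ¬a) (no ¬b) (inj₂ _) (inj₂ _) _ _ =
  mk⇔ (λ { (inj₁ (a , _)) → ¬a a ; (inj₂ (_ , b)) → ¬b b }) λ ()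
crossing⇔KAdj (yes _) _ (inj₂ _) _ () _
crossing⇔KAdj (no _)  _ (inj₁ _) _ () _
crossing⇔KAdj _ (yes _) _ (inj₂ _) _ ()
crossing⇔KAdj _ (no _)  _ (inj₁ _) _ ()

DifferBy : ℕ → ℕ → ℕ → Set
DifferBy g x y = y ≡ x + g ⊎ x ≡ y + g

m≡g+t∧n≡3g+t⇒n≡m+2g : ∀ g {t m n} → m ≡ g + t → n ≡ 3 * g + t → n ≡ m + (g + g)
m≡g+t∧n≡3g+t⇒n≡m+2g g {t} refl refl = 3g+t≡g+t+2g g t
  where
  3g+t≡g+t+2g : ∀ g t → 3 * g + t ≡ (g + t) + (g + g)
  3g+t≡g+t+2g = solve-∀

module _ {g : ℕ} (g>0 : 0 < g) where

  private
    m+k≢m : ∀ m {k} → 0 < k → m + k ≢ m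
    m+k≢m m k>0 = <⇒≢ (m<m+n m k>0) ∘ sym

    x+2g≢x+g : ∀ x → x + g + g ≢ x + g
    x+2g≢x+g x = m+k≢m (x + g) g>0

    x≢x+3g : ∀ x → x ≢ x + g + g + g
    x≢x+3g x eq = m+k≢m x (<-≤-trans g>0 (m≤m+n g (g + g)))
                           (trans (assoc3 x g) (sym eq))
      where
      assoc3 : ∀ a g → a + (g + (g + g)) ≡ a + g + g + g
      assoc3 = solve-∀

    above : ∀ x z → DifferBy g (x + g) z → DifferBy g x z → ⊥
    above x z (inj₁ refl) (inj₁ eq)   = x+2g≢x+g x eq
    above x z (inj₁ refl) (inj₂ eq)   = x≢x+3g x eq
    above x z (inj₂ eq)   (inj₁ refl) = x+2g≢x+g x (sym eq)
    above x z (inj₂ eq)   (inj₂ refl) = x+2g≢x+g z eq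

    below : ∀ y z → DifferBy g y z → DifferBy g (y + g) z → ⊥
    below y z (inj₁ refl) (inj₁ eq) = x+2g≢x+g y (sym eq)
    below y z (inj₁ refl) (inj₂ eq) = x+2g≢x+g y (sym eq)
    below y z (inj₂ refl) (inj₁ eq) = x≢x+3g z eq
    below y z (inj₂ refl) (inj₂ eq) = x+2g≢x+g z eq

  ¬DifferBy-triangle : ∀ x y z → DifferBy g x y → DifferBy g y z → DifferBy g x z → ⊥
  ¬DifferBy-triangle x y z (inj₁ refl) = above x z
  ¬DifferBy-triangle x y z (inj₂ refl) = below y z

module _ (Γ : Graph) where
  open Graph Γ renaming (sym to ~-sym)

  walk₀⇒≡ : ∀ {x y} → Walk Γ x y 0 → x ≡ y
  walk₀⇒≡ here = refl

  walk₁⇒~ : ∀ {x y} → Walk Γ x y 1 → x ~ y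
  walk₁⇒~ (step p here) = p

  dist-0 : ∀ {x} → Dist Γ x x 0
  dist-0 = here , λ _ ()

  dist-1 : ∀ {x y} → x ~ y → Dist Γ x y 1
  dist-1 {x} {y} x~y = step x~y here , λ
    { zero _ w → irr (subst (_~ y) (walk₀⇒≡ w) x~y) ; (suc _) (s≤s ()) _ }

  dist-2 : ∀ {x y z} → x ~ y → y ~ z → ¬ x ~ z → x ≢ z → Dist Γ x z 2
  dist-2 x~y y~z ≁ ≢ = step x~y (step y~z here) , λ
    { zero       _                 w → ≢ (walk₀⇒≡ w)
    ; (suc zero) _                 w → ≁ (walk₁⇒~ w)
    ; (suc (suc _)) (s≤s (s≤s ())) _
    }

  deg : Fin N → ℕ
  deg v = count (λ x → adj? x v)

  common : Fin N → Fin N → ℕ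
  common a b = count (λ x → adj? x a ×-dec adj? x b)

  common-sym : ∀ a b → common a b ≡ common b a
  common-sym a b = count-cong (λ x → adj? x a ×-dec adj? x b) (λ x → adj? x b ×-dec adj? x a)
                              (λ x → mk⇔ swap swap)

  module DiameterAtMost2 (diam≤2 : ∀ a b → ∃[ k ] (k ≤ 2 × Dist Γ a b k)) where

    dist≤2 : ∀ {x y j} → Dist Γ x y j → j ≤ 2
    dist≤2 {j = zero}              _ = z≤n
    dist≤2 {j = suc zero}          _ = s≤s z≤n
    dist≤2 {j = suc (suc zero)}    _ = s≤s (s≤s z≤n)
    dist≤2 {x} {y} {suc (suc (suc j))} (_ , shortest) with diam≤2 x y
    ... | k , k≤2 , w , _ = ⊥-elim (shortest k (≤-<-trans k≤2 (s≤s (s≤s (s≤s z≤n)))) w)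

    Farther : Fin N → Fin N → Fin N → Set
    Farther a b x = x ~ a × ¬ x ~ b × x ≢ b

    Farther? : ∀ a b → Decidable (Farther a b)
    Farther? a b x = adj? x a ×-dec ¬? (adj? x b) ×-dec ¬? (x ≟ b)

    InW⇔ : ∀ {a b x} → a ~ b → InW Γ a b x ⇔ (x ≡ a ⊎ Farther a b x)
    InW⇔ {a} {b} {x} a~b = mk⇔ to from
      where
      -- d(x,b) ≤ 2 leaves only d(x,a) = 0, or d(x,a) = 1 and d(x,b) = 2.
      to : InW Γ a b x → x ≡ a ⊎ Farther a b x
      to (zero , _ , (w , _) , _) = inj₁ (walk₀⇒≡ w)
      to (suc zero , suc (suc zero) , (w , _) , (_ , shortest) , _) =
        inj₂ (walk₁⇒~ w , (λ x~b → shortest 1 (s≤s (s≤s z≤n)) (step x~b here))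
                        , (λ { refl → shortest 0 (s≤s z≤n) here }))
      to (suc zero , zero , _ , _ , ())
      to (suc zero , suc zero , _ , _ , s≤s ())
      to (suc zero , suc (suc (suc _)) , _ , d , _) =
        ⊥-elim (≤⇒≯ (dist≤2 d) (s≤s (s≤s (s≤s z≤n))))
      to (suc (suc _) , _ , _ , d , i<j) =
        ⊥-elim (≤⇒≯ (dist≤2 d) (≤-<-trans (s≤s (s≤s z≤n)) i<j))
      from : x ≡ a ⊎ Farther a b x → InW Γ a b x
      from (inj₁ refl)              = 0 , 1 , dist-0 , dist-1 a~b , s≤s z≤n
      from (inj₂ (x~a , x≁b , x≢b)) = 1 , 2 , dist-1 x~a , dist-2 x~a a~b x≁b x≢b , s≤s (s≤s z≤n)

    HasSize-InW⇒≡1+Farther : ∀ {a b m} → a ~ b → HasSize Γ (InW Γ a b) m →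
                             m ≡ suc (count (Farther? a b))
    HasSize-InW⇒≡1+Farther {a} {b} a~b (s , ∈s⇔InW , refl) = begin
      ∣ s ∣
        ≡⟨ ∣p∣≡count∈ s ⟩
      count (_∈? s)
        ≡⟨ count-cong (_∈? s) W? (λ x → InW⇔ a~b ⇔-∘ ∈s⇔InW x) ⟩
      count W?
        ≡⟨ count-⊎ (_≟ a) (Farther? a b) (λ { x refl (a~a , _) → irr a~a }) ⟩
      count (_≟ a) + count (Farther? a b)
        ≡⟨ cong (_+ count (Farther? a b)) (count-≡ a) ⟩
      suc (count (Farther? a b)) ∎
      where
      open ≡-Reasoning
      W? : Decidable (λ x → x ≡ a ⊎ Farther a b x)
      W? x = (x ≟ a) ⊎-dec Farther? a b x

    deg≡1+common+Farther : ∀ {a b} → a ~ b → deg a ≡ suc (common a b + count (Farther? a b))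
    deg≡1+common+Farther {a} {b} a~b = begin
      deg a
        ≡⟨ count-cong (λ x → adj? x a) Split? neighbour⇔ ⟩
      count Split?
        ≡⟨ count-⊎ (_≟ b) Rest? b-apart ⟩
      count (_≟ b) + count Rest?
        ≡⟨ cong₂ _+_ (count-≡ b) (count-⊎ Both? (Farther? a b) both-apart) ⟩
      suc (common a b + count (Farther? a b)) ∎
      where
      open ≡-Reasoning
      Both? : Decidable (λ x → x ~ a × x ~ b)
      Both? x = adj? x a ×-dec adj? x b
      Rest? : Decidable (λ x → (x ~ a × x ~ b) ⊎ Farther a b x)
      Rest? x = Both? x ⊎-dec Farther? a b x
      Split? : Decidable (λ x → x ≡ b ⊎ (x ~ a × x ~ b) ⊎ Farther a b x)
      Split? x = (x ≟ b) ⊎-dec Rest? x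
      neighbour⇔ : ∀ x → x ~ a ⇔ (x ≡ b ⊎ (x ~ a × x ~ b) ⊎ Farther a b x)
      neighbour⇔ x = mk⇔ split [ (λ { refl → ~-sym a~b }) , [ proj₁ , proj₁ ]′ ]′
        where
        split : x ~ a → x ≡ b ⊎ (x ~ a × x ~ b) ⊎ Farther a b x
        split x~a with x ≟ b | adj? x b
        ... | yes x≡b | _       = inj₁ x≡b
        ... | no  _   | yes x~b = inj₂ (inj₁ (x~a , x~b))
        ... | no  x≢b | no  x≁b = inj₂ (inj₂ (x~a , x≁b , x≢b))
      b-apart : ∀ x → x ≡ b → (x ~ a × x ~ b) ⊎ Farther a b x → ⊥
      b-apart x refl (inj₁ (_ , b~b))     = irr b~b
      b-apart x refl (inj₂ (_ , _ , b≢b)) = b≢b refl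
      both-apart : ∀ x → x ~ a × x ~ b → Farther a b x → ⊥
      both-apart x (_ , x~b) (_ , x≁b , _) = x≁b x~b

    HasSize-InW⇒+common≡deg : ∀ {a b m} → a ~ b → HasSize Γ (InW Γ a b) m →
                              m + common a b ≡ deg a
    HasSize-InW⇒+common≡deg {a} {b} {m} a~b size = begin
      m + common a b
        ≡⟨ cong (_+ common a b) (HasSize-InW⇒≡1+Farther a~b size) ⟩
      suc (count (Farther? a b) + common a b)
        ≡⟨ cong suc (+-comm (count (Farther? a b)) (common a b)) ⟩
      suc (common a b + count (Farther? a b))
        ≡⟨ sym (deg≡1+common+Farther a~b) ⟩
      deg a ∎
      where open ≡-Reasoning

    HasSize-InWʳ⇒+common≡deg : ∀ {a b m} → a ~ b → HasSize Γ (InW Γ b a) m →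
                               m + common a b ≡ deg b
    HasSize-InWʳ⇒+common≡deg {a} {b} {m} a~b size =
      trans (cong (m +_) (common-sym a b)) (HasSize-InW⇒+common≡deg (~-sym a~b) size)

  complete-bipartite : {P : Fin N → Set} (P? : Decidable P) →
    (∀ u v → u ~ v ⇔ (P u × ¬ P v ⊎ ¬ P u × P v)) → IsoToK Γ (count P?) (count (¬? ∘ P?))
  complete-bipartite P? crossing =
    f , λ u v → crossing⇔KAdj (P? u) (P? v) _ _ (side u) (side v) ⇔-∘ crossing u v
    where
    f = proj₁ (partition↔ P?)
    side = proj₂ (partition↔ P?)

  module GNDB3-Diameter2 (diam : Diameter2 Γ) (gndb : GNDB3 Γ) where
    open DiameterAtMost2 (proj₁ diam)

    γ : ℕ
    γ = proj₁ gndb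

    γ>0 : 0 < γ
    γ>0 = proj₁ (proj₂ gndb)

    γ≢3γ : γ ≢ 3 * γ
    γ≢3γ = <⇒≢ (m<m+n γ (<-≤-trans γ>0 (m≤m+n γ (γ + 0))))

    edge-degrees : ∀ {a b} → a ~ b →
        (deg a ≡ γ + common a b × deg b ≡ 3 * γ + common a b)
      ⊎ (deg a ≡ 3 * γ + common a b × deg b ≡ γ + common a b)
    edge-degrees {a} {b} a~b with proj₂ (proj₂ gndb) a b a~b
    ... | inj₁ (Wab , Wba) = inj₁ (sym (HasSize-InW⇒+common≡deg a~b Wab)
                                 , sym (HasSize-InWʳ⇒+common≡deg a~b Wba))
    ... | inj₂ (Wba , Wab) = inj₂ (sym (HasSize-InW⇒+common≡deg a~b Wab)
                                 , sym (HasSize-InWʳ⇒+common≡deg a~b Wba))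

    degree-gap : ∀ {a b} → a ~ b → DifferBy (γ + γ) (deg a) (deg b)
    degree-gap a~b with edge-degrees a~b
    ... | inj₁ (da , db) = inj₁ (m≡g+t∧n≡3g+t⇒n≡m+2g γ da db)
    ... | inj₂ (da , db) = inj₂ (m≡g+t∧n≡3g+t⇒n≡m+2g γ db da)

    triangle-free : ∀ {x a b} → x ~ a → x ~ b → a ~ b → ⊥
    triangle-free {x} {a} {b} x~a x~b a~b =
      ¬DifferBy-triangle (<-≤-trans γ>0 (m≤m+n γ γ)) (deg x) (deg a) (deg b)
        (degree-gap x~a) (degree-gap a~b) (degree-gap x~b)

    common≡0 : ∀ {a b} → a ~ b → common a b ≡ 0
    common≡0 {a} {b} a~b = count-none (λ x → adj? x a ×-dec adj? x b)
                                      λ x (x~a , x~b) → triangle-free x~a x~b a~b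

    drop-common : ∀ {a b d c} → a ~ b → d ≡ c + common a b → d ≡ c
    drop-common {c = c} a~b d≡c+t =
      trans d≡c+t (trans (cong (c +_) (common≡0 a~b)) (+-identityʳ c))

    edge-degrees₀ : ∀ {a b} → a ~ b → (deg a ≡ γ × deg b ≡ 3 * γ) ⊎ (deg a ≡ 3 * γ × deg b ≡ γ)
    edge-degrees₀ a~b with edge-degrees a~b
    ... | inj₁ (da , db) = inj₁ (drop-common a~b da , drop-common a~b db)
    ... | inj₂ (da , db) = inj₂ (drop-common a~b da , drop-common a~b db)

    Low High : Fin N → Set
    Low  v = deg v ≡ γ
    High v = deg v ≡ 3 * γ

    High? : Decidable High
    High? v = deg v ≟ℕ 3 * γ

    Low⇒¬High : ∀ {v} → Low v → ¬ High v
    Low⇒¬High dv dv′ = γ≢3γ (trans (sym dv) dv′)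

    has-neighbour : ∀ v → ∃ (v ~_)
    has-neighbour v with proj₂ diam | proj₁ diam v (proj₁ (proj₂ diam))
    ... | a , _ , step a~c _ , _ | zero , _ , w , _ rewrite walk₀⇒≡ w = _ , a~c
    ... | _ | suc _ , _ , step v~c _ , _ = _ , v~c

    Low⊎High : ∀ v → Low v ⊎ High v
    Low⊎High v with edge-degrees₀ (proj₂ (has-neighbour v))
    ... | inj₁ (dv , _) = inj₁ dv
    ... | inj₂ (dv , _) = inj₂ dv

    ¬High⇒Low : ∀ {v} → ¬ High v → Low v
    ¬High⇒Low {v} ¬high with Low⊎High v
    ... | inj₁ low  = low
    ... | inj₂ high = ⊥-elim (¬high high)

    Low~High : ∀ {u v} → Low u → High v → u ~ v
    Low~High {u} {v} du dv with proj₁ diam u v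
    ... | zero , _ , w , _ rewrite walk₀⇒≡ w = ⊥-elim (Low⇒¬High du dv)
    ... | suc zero , _ , w , _ = walk₁⇒~ w
    ... | suc (suc zero) , _ , step u~w (step w~v here) , _
        with edge-degrees₀ u~w | edge-degrees₀ w~v
    ...   | inj₂ (du′ , _) | _               = ⊥-elim (Low⇒¬High du du′)
    ...   | inj₁ _         | inj₂ (_ , dv′)  = ⊥-elim (Low⇒¬High dv′ dv)
    ...   | inj₁ (_ , dw)  | inj₁ (dw′ , _)  = ⊥-elim (Low⇒¬High dw′ dw)
    Low~High du dv | suc (suc (suc _)) , s≤s (s≤s ()) , _

    ~⇔crossing : ∀ u v → u ~ v ⇔ (High u × ¬ High v ⊎ ¬ High u × High v)
    ~⇔crossing u v = mk⇔ to from
      where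
      to : u ~ v → High u × ¬ High v ⊎ ¬ High u × High v
      to u~v with edge-degrees₀ u~v
      ... | inj₁ (du , dv) = inj₂ (Low⇒¬High du , dv)
      ... | inj₂ (du , dv) = inj₁ (du , Low⇒¬High dv)
      from : High u × ¬ High v ⊎ ¬ High u × High v → u ~ v
      from (inj₁ (hu , ¬hv)) = ~-sym (Low~High (¬High⇒Low ¬hv) hu)
      from (inj₂ (¬hu , hv)) = Low~High (¬High⇒Low ¬hu) hv

    low-and-high : ∃[ u ] ∃[ v ] (Low u × High v)
    low-and-high with has-neighbour (proj₁ (proj₂ diam))
    ... | _ , a~b with edge-degrees₀ a~b
    ...   | inj₁ (da , db) = _ , _ , da , db
    ...   | inj₂ (da , db) = _ , _ , db , da

    count-High : count High? ≡ γ
    count-High with low-and-high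
    ... | u , _ , du , _ = trans (count-cong High? (λ x → adj? x u) High⇔~u) du
      where
      High⇔~u : ∀ x → High x ⇔ x ~ u
      High⇔~u x = mk⇔ (λ hx → ~-sym (Low~High du hx)) λ x~u →
        [ proj₁ , (λ (_ , hu) → ⊥-elim (Low⇒¬High du hu)) ]′ (Equivalence.to (~⇔crossing x u) x~u)

    count-Low : count (¬? ∘ High?) ≡ 3 * γ
    count-Low with low-and-high
    ... | _ , v , _ , dv = trans (count-cong (¬? ∘ High?) (λ x → adj? x v) ¬High⇔~v) dv
      where
      ¬High⇔~v : ∀ x → (¬ High x) ⇔ x ~ v
      ¬High⇔~v x = mk⇔ (λ ¬hx → Low~High (¬High⇒Low ¬hx) dv) λ x~v →
        [ (λ (_ , ¬hv) → ⊥-elim (¬hv dv)) , proj₁ ]′ (Equivalence.to (~⇔crossing x v) x~v)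

lemma2p3 : (Γ : Graph) → Connected Γ → Diameter2 Γ → GNDB3 Γ →
    ∃[ n ] (0 < n × IsoToK Γ n (3 * n))
lemma2p3 Γ _ diam gndb =
  γ , γ>0 , subst₂ (IsoToK Γ) count-High count-Low (complete-bipartite Γ High? ~⇔crossing)
  where open GNDB3-Diameter2 Γ diam gndb
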